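{- Let $n>1$ and consider a zip tree with $n$ nodes whose ranks are independent random variables, each geometric with mean $1$ (rank $j\in\{0,1,2,\dots\}$ with probability $1/2^{j+1}$), independent of the keys. Then for a node $x$ of rank $k$ (i.e., conditioned on $x.\mathit{rank}=k$), the expected number of descendants of $x$ (including $x$ itself) is at most $3\cdot 2^k-1$. The expected number of descendants of an arbitrary node is at most $(3/2)\lg n+3$.
   Context: A zip tree is a binary search tree (distinct keys in symmetric order: left-subtree keys smaller, right-subtree keys larger) in which each node has a numeric rank and the parent of a node has rank strictly greater than that of its left child and greater than or equal to that of its right child. The descendants of a node are the nodes of its subtree, including itself. $\lg$ denotes the base-$2$ logarithm. -}

module Defs where

open import Data.Nat as ℕ using (ℕ; zero; suc; _^_)
open import Data.Fin as Fin using (Fin; zero; suc)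
open import Data.Fin.Properties using (_≟_)
open import Data.Integer as ℤ using (ℤ; +_)
open import Data.Rational as ℚ using (ℚ; 0ℚ; 1ℚ; _+_; _*_; _/_; ↥_; ↧ₙ_)
open import Data.List as List using (List; []; _∷_; concatMap; map; foldr; upTo)
open import Data.Vec.Functional as V using (Vector)
open import Data.Product using (_×_)
open import Data.Sum using (_⊎_)
open import Data.Unit using (⊤)
open import Data.Bool using (Bool; true; false; if_then_else_)
open import Relation.Nullary.Decidable using (⌊_⌋)
open import Relation.Binary.PropositionalEquality using (_≡_)

-- Binary trees whose nodes carry keys from Fin n (the n node keys,
-- w.l.o.g. 0,...,n-1 since only their relative order matters).
-- Ranks are given by a rank assignment  ρ : Fin n → ℕ .

data Tree (n : ℕ) : Set where
  leaf : Tree n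
  node : Tree n → Fin n → Tree n → Tree n

AllT : ∀ {n} → (Fin n → Set) → Tree n → Set
AllT P leaf = ⊤
AllT P (node l k r) = AllT P l × P k × AllT P r

data _∈T_ {n : ℕ} (x : Fin n) : Tree n → Set where
  here  : ∀ {l r} → x ∈T node l x r
  left  : ∀ {l k r} → x ∈T l → x ∈T node l k r
  right : ∀ {l k r} → x ∈T r → x ∈T node l k r

LeftRankOK : ∀ {n} → (Fin n → ℕ) → Fin n → Tree n → Set
LeftRankOK ρ k leaf = ⊤
LeftRankOK ρ k (node _ c _) = ρ c ℕ.< ρ k

RightRankOK : ∀ {n} → (Fin n → ℕ) → Fin n → Tree n → Set
RightRankOK ρ k leaf = ⊤
RightRankOK ρ k (node _ c _) = ρ c ℕ.≤ ρ k

IsZip : ∀ {n} → (Fin n → ℕ) → Tree n → Set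
IsZip ρ leaf = ⊤
IsZip ρ (node l k r) =
  AllT (λ y → y Fin.< k) l × AllT (λ y → k Fin.< y) r ×
  LeftRankOK ρ k l × RightRankOK ρ k r × IsZip ρ l × IsZip ρ r

IsZipTreeOn : ∀ {n} → (Fin n → ℕ) → Tree n → Set
IsZipTreeOn ρ t = IsZip ρ t × (∀ i → i ∈T t)

size : ∀ {n} → Tree n → ℕ
size leaf = 0
size (node l _ r) = suc (size l ℕ.+ size r)

-- number of descendants of node x (size of the subtree rooted at x,
-- including x); 0 if x does not occur
desc : ∀ {n} → Fin n → Tree n → ℕ
desc x leaf = 0
desc x t@(node l k r) = if ⌊ x ≟ k ⌋ then size t else desc x l ℕ.+ desc x r

ℕ→ℚ : ℕ → ℚ
ℕ→ℚ m = (+ m) / 1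

½ : ℚ
½ = (+ 1) / 2

½^ : ℕ → ℚ
½^ zero = 1ℚ
½^ (suc m) = ½ * ½^ m

weight : (n : ℕ) → Vector ℕ n → ℚ
weight zero v = 1ℚ
weight (suc n) v = ½^ (suc (v zero)) * weight n (V.tail v)

-- all rank vectors with every entry < M (truncation of the sample space)
rankVecs : (n M : ℕ) → List (Vector ℕ n)
rankVecs zero M = V.[] ∷ []
rankVecs (suc n) M = concatMap (λ j → map (j V.∷_) (rankVecs n M)) (upTo M)

sumℚ : List ℚ → ℚ
sumℚ = foldr _+_ 0ℚ

-- partial sum (truncation M) of E[ desc(x) ]
partialE : (n M : ℕ) → ((Fin n → ℕ) → Tree n) → Fin n → ℚ
partialE n M zt x =
  sumℚ (map (λ v → weight n v * ℕ→ℚ (desc x (zt v))) (rankVecs n M))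

-- partial sum (truncation M) of E[ desc(x) ; rank x = k ]
-- (unnormalised; divide by P(rank x = k) = 1/2^(k+1) for the conditional)
partialECond : (n M : ℕ) → ((Fin n → ℕ) → Tree n) → Fin n → ℕ → ℚ
partialECond n M zt x k =
  sumℚ (map (λ v → if ⌊ v x ℕ.≟ k ⌋ then weight n v * ℕ→ℚ (desc x (zt v)) else 0ℚ)
            (rankVecs n M))

-- q ≤ lg n , i.e. 2^q ≤ n : for q = a/b in lowest terms with a > 0,
-- this is 2^a ≤ n^b ; it holds trivially when q ≤ 0 (n ≥ 1).
_≤lg_ : ℚ → ℕ → Set
q ≤lg n = (↥ q ℤ.≤ + 0) ⊎ (2 ^ ℤ.∣ ↥ q ∣ ℕ.≤ n ^ (↧ₙ q))

-- If x has rank k, its subtree consists of x, the keys just below x down to the first one of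
-- rank ≥ k, and the keys just above x up to the first one of rank > k: a key outside a subtree
-- lies entirely on one side of it. So desc x is at most the number of d ≥ 0 for which the d keys
-- below x all have rank < k, plus the number of d ≥ 1 for which the d keys above x all have
-- rank ≤ k. By independence of the ranks these events (together with rank x = k) have
-- probability at most 2^-(k+1) (1 - 2^-k)^d and 2^-(k+1) (1 - 2^-(k+1))^d, and the two geometric
-- series give 2^-(k+1) (3·2^k - 1). For an arbitrary node, sum this over the ranks
-- k < K := ⌊lg n⌋ + 1, each term being at most 3/2, and bound desc x by n when rank x ≥ K, which
-- has probability at most 2^-K ≤ 1/n. Expectations are truncated to ranks below M, and every
-- bound is uniform in M.

module Submission where

open import Defs
open import Data.Nat as ℕ using (ℕ; suc; _^_; _∸_)
open import Data.Fin using (Fin)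
open import Data.Integer using (+_)
open import Data.Rational using (ℚ; _≤_; _*_; _-_; _/_)
open import Data.Product using (_×_)

open import Data.Bool using (Bool; true; false; if_then_else_; not)
open import Data.Empty using (⊥-elim)
open import Data.Fin as Fin using (toℕ)
import Data.Fin.Properties as Finₚ
open import Data.Integer as ℤ using (-[1+_])
import Data.Integer.Properties as ℤₚ
open import Data.List using (List; []; _∷_; _++_; map; concatMap; upTo; applyUpTo)
import Data.List.Properties as Listₚ
import Data.Nat.Coprimality as Coprime
open import Data.Nat using (zero; z≤n; s≤s; _≡ᵇ_; _<ᵇ_)
import Data.Nat.Properties as ℕₚ
open import Data.Product using (Σ-syntax; _,_; proj₁; proj₂)
open import Data.Rational using (0ℚ; 1ℚ; _+_; -_; mkℚ; *≤*; nonNegative; +-*-rawSemiring)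
import Data.Rational.Properties as ℚₚ
open import Data.Rational.Solver using (module +-*-Solver)
open import Data.Sum using (_⊎_; inj₁; inj₂)
open import Data.Unit using (tt)
open import Data.Vec.Functional as Vector using (Vector)
open import Function using (_∘_)
open import Relation.Binary.PropositionalEquality
open import Relation.Nullary using (¬_; yes; no)
open import Relation.Nullary.Decidable using (⌊_⌋)

open +-*-Solver using (solve; _:+_; _:-_; _:*_; _:=_; con)
open import Algebra.Definitions.RawSemiring +-*-rawSemiring using () renaming (_^_ to _^ℚ_)

ℕ→ℚ≡mkℚ : ∀ m → ℕ→ℚ m ≡ mkℚ (+ m) 0 (Coprime.sym (Coprime.1-coprimeTo m))
ℕ→ℚ≡mkℚ m = ℚₚ.normalize-coprime (Coprime.sym (Coprime.1-coprimeTo m))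

ℕ→ℚ-+ : ∀ m n → ℕ→ℚ (m ℕ.+ n) ≡ ℕ→ℚ m + ℕ→ℚ n
ℕ→ℚ-+ m n = begin
  (+ (m ℕ.+ n)) / 1
    ≡⟨ cong₂ (λ i j → (i ℤ.+ j) / 1) (sym (ℤₚ.*-identityʳ (+ m))) (sym (ℤₚ.*-identityʳ (+ n))) ⟩
  ((+ m ℤ.* + 1) ℤ.+ (+ n ℤ.* + 1)) / 1
    ≡⟨ sym (cong₂ _+_ (ℕ→ℚ≡mkℚ m) (ℕ→ℚ≡mkℚ n)) ⟩
  ℕ→ℚ m + ℕ→ℚ n ∎
  where open ≡-Reasoning

ℕ→ℚ-* : ∀ m n → ℕ→ℚ (m ℕ.* n) ≡ ℕ→ℚ m * ℕ→ℚ n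
ℕ→ℚ-* m n = begin
  (+ (m ℕ.* n)) / 1         ≡⟨ cong (_/ 1) (ℤₚ.pos-* m n) ⟩
  (+ m ℤ.* + n) / 1         ≡⟨ sym (cong₂ _*_ (ℕ→ℚ≡mkℚ m) (ℕ→ℚ≡mkℚ n)) ⟩
  ℕ→ℚ m * ℕ→ℚ n             ∎
  where open ≡-Reasoning

ℕ→ℚ-∸ : ∀ {m n} → n ℕ.≤ m → ℕ→ℚ (m ∸ n) ≡ ℕ→ℚ m - ℕ→ℚ n
ℕ→ℚ-∸ {m} {n} n≤m = begin
  ℕ→ℚ (m ∸ n)
    ≡⟨ solve 2 (λ a b → a := (a :+ b) :- b) refl (ℕ→ℚ (m ∸ n)) (ℕ→ℚ n) ⟩
  ℕ→ℚ (m ∸ n) + ℕ→ℚ n - ℕ→ℚ n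
    ≡⟨ cong (_- ℕ→ℚ n) (trans (sym (ℕ→ℚ-+ (m ∸ n) n)) (cong ℕ→ℚ (ℕₚ.m∸n+n≡m n≤m))) ⟩
  ℕ→ℚ m - ℕ→ℚ n ∎
  where open ≡-Reasoning

ℕ→ℚ-mono-≤ : ∀ {m n} → m ℕ.≤ n → ℕ→ℚ m ≤ ℕ→ℚ n
ℕ→ℚ-mono-≤ {m} {n} m≤n rewrite ℕ→ℚ≡mkℚ m | ℕ→ℚ≡mkℚ n = *≤* (ℤₚ.*-monoʳ-≤-nonNeg (+ 1) (ℤ.+≤+ m≤n))

0≤ℕ→ℚ : ∀ m → 0ℚ ≤ ℕ→ℚ m
0≤ℕ→ℚ m = ℕ→ℚ-mono-≤ {0} {m} z≤n

0≤½ : 0ℚ ≤ ½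
0≤½ = ℚₚ.≤ᵇ⇒≤ tt

*-nonNeg : ∀ {p q} → 0ℚ ≤ p → 0ℚ ≤ q → 0ℚ ≤ p * q
*-nonNeg {p} {q} 0≤p 0≤q =
  ℚₚ.nonNegative⁻¹ _ {{ℚₚ.nonNeg*nonNeg⇒nonNeg p {{nonNegative 0≤p}} q {{nonNegative 0≤q}}}}

+-nonNeg : ∀ {p q} → 0ℚ ≤ p → 0ℚ ≤ q → 0ℚ ≤ p + q
+-nonNeg {p} {q} 0≤p 0≤q =
  ℚₚ.nonNegative⁻¹ _ {{ℚₚ.nonNeg+nonNeg⇒nonNeg p {{nonNegative 0≤p}} q {{nonNegative 0≤q}}}}

*-monoˡ-≤-nonNeg′ : ∀ {r p q} → 0ℚ ≤ r → p ≤ q → r * p ≤ r * q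
*-monoˡ-≤-nonNeg′ {r} 0≤r = ℚₚ.*-monoˡ-≤-nonNeg r {{nonNegative 0≤r}}

*-monoʳ-≤-nonNeg′ : ∀ {r p q} → 0ℚ ≤ r → p ≤ q → p * r ≤ q * r
*-monoʳ-≤-nonNeg′ {r} 0≤r = ℚₚ.*-monoʳ-≤-nonNeg r {{nonNegative 0≤r}}

*-mono-≤-nonNeg : ∀ {p q r s} → 0ℚ ≤ p → 0ℚ ≤ s → p ≤ q → r ≤ s → p * r ≤ q * s
*-mono-≤-nonNeg 0≤p 0≤s p≤q r≤s = ℚₚ.≤-trans (*-monoˡ-≤-nonNeg′ 0≤p r≤s) (*-monoʳ-≤-nonNeg′ 0≤s p≤q)

p≤p+q : ∀ {p q} → 0ℚ ≤ q → p ≤ p + q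
p≤p+q {p} 0≤q = ℚₚ.≤-trans (ℚₚ.≤-reflexive (sym (ℚₚ.+-identityʳ p))) (ℚₚ.+-monoʳ-≤ p 0≤q)

q≤p+q : ∀ {p q} → 0ℚ ≤ p → q ≤ p + q
q≤p+q {p} {q} 0≤p = ℚₚ.≤-trans (ℚₚ.≤-reflexive (sym (ℚₚ.+-identityˡ q))) (ℚₚ.+-monoˡ-≤ q 0≤p)

p≤q⇒0≤q-p : ∀ {p q} → p ≤ q → 0ℚ ≤ q - p
p≤q⇒0≤q-p {p} {q} p≤q =
  ℚₚ.≤-trans (ℚₚ.≤-reflexive (sym (ℚₚ.+-inverseʳ q))) (ℚₚ.+-monoʳ-≤ q (ℚₚ.neg-antimono-≤ p≤q))

p-q≤p : ∀ p {q} → 0ℚ ≤ q → p - q ≤ p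
p-q≤p p 0≤q = ℚₚ.≤-trans (ℚₚ.+-monoʳ-≤ p (ℚₚ.neg-antimono-≤ 0≤q)) (ℚₚ.≤-reflexive (ℚₚ.+-identityʳ p))

0≤½^ : ∀ m → 0ℚ ≤ ½^ m
0≤½^ zero = ℚₚ.≤ᵇ⇒≤ tt
0≤½^ (suc m) = *-nonNeg 0≤½ (0≤½^ m)

½^≤1 : ∀ m → ½^ m ≤ 1ℚ
½^≤1 zero = ℚₚ.≤-refl
½^≤1 (suc m) = ℚₚ.≤-trans (*-monoˡ-≤-nonNeg′ 0≤½ (½^≤1 m)) (ℚₚ.≤ᵇ⇒≤ tt)

½^*2^≡1 : ∀ m → ½^ m * ℕ→ℚ (2 ^ m) ≡ 1ℚ
½^*2^≡1 zero = refl
½^*2^≡1 (suc m) = begin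
  (½ * ½^ m) * ℕ→ℚ (2 ℕ.* 2 ^ m)
    ≡⟨ cong ((½ * ½^ m) *_) (ℕ→ℚ-* 2 (2 ^ m)) ⟩
  (½ * ½^ m) * (ℕ→ℚ 2 * ℕ→ℚ (2 ^ m))
    ≡⟨ solve 2 (λ h t → (con ½ :* h) :* (con (ℕ→ℚ 2) :* t) := h :* t) refl (½^ m) (ℕ→ℚ (2 ^ m)) ⟩
  ½^ m * ℕ→ℚ (2 ^ m)
    ≡⟨ ½^*2^≡1 m ⟩
  1ℚ ∎
  where open ≡-Reasoning

∑< : ℕ → (ℕ → ℚ) → ℚ
∑< zero    f = 0ℚ
∑< (suc N) f = f 0 + ∑< N (f ∘ suc)

syntax ∑< N (λ d → e) = ∑[ d < N ] e

∑<-mono : ∀ {f g} N → (∀ d → d ℕ.< N → f d ≤ g d) → ∑< N f ≤ ∑< N g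
∑<-mono zero    f≤g = ℚₚ.≤-refl
∑<-mono (suc N) f≤g = ℚₚ.+-mono-≤ (f≤g 0 (s≤s z≤n)) (∑<-mono N (λ d d<N → f≤g (suc d) (s≤s d<N)))

∑<-cong : ∀ {f g} N → (∀ d → f d ≡ g d) → ∑< N f ≡ ∑< N g
∑<-cong zero    f≡g = refl
∑<-cong (suc N) f≡g = cong₂ _+_ (f≡g 0) (∑<-cong N (f≡g ∘ suc))

∑<-nonNeg : ∀ {f} N → (∀ d → 0ℚ ≤ f d) → 0ℚ ≤ ∑< N f
∑<-nonNeg zero    0≤f = ℚₚ.≤-refl
∑<-nonNeg (suc N) 0≤f = +-nonNeg (0≤f 0) (∑<-nonNeg N (0≤f ∘ suc))

∑<-*-distribˡ : ∀ {f} c N → ∑[ d < N ] (c * f d) ≡ c * ∑< N f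
∑<-*-distribˡ c zero = sym (ℚₚ.*-zeroʳ c)
∑<-*-distribˡ {f} c (suc N) =
  trans (cong (_+_ (c * f 0)) (∑<-*-distribˡ c N)) (sym (ℚₚ.*-distribˡ-+ c (f 0) _))

∑<-*-distribʳ : ∀ {f} c N → ∑[ d < N ] (f d * c) ≡ ∑< N f * c
∑<-*-distribʳ {f} c N =
  trans (∑<-cong N (λ d → ℚₚ.*-comm (f d) c)) (trans (∑<-*-distribˡ c N) (ℚₚ.*-comm c (∑< N f)))

∑<-const : ∀ c N → ∑[ d < N ] c ≡ ℕ→ℚ N * c
∑<-const c zero = sym (ℚₚ.*-zeroˡ c)
∑<-const c (suc N) = begin
  c + ∑[ d < N ] c          ≡⟨ cong (_+_ c) (∑<-const c N) ⟩
  c + ℕ→ℚ N * c             ≡⟨ solve 2 (λ c x → c :+ x :* c := (con 1ℚ :+ x) :* c) refl c (ℕ→ℚ N) ⟩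
  (1ℚ + ℕ→ℚ N) * c          ≡⟨ cong (_* c) (sym (ℕ→ℚ-+ 1 N)) ⟩
  ℕ→ℚ (suc N) * c           ∎
  where open ≡-Reasoning

term≤∑< : ∀ {f m} N → (∀ d → 0ℚ ≤ f d) → m ℕ.< N → f m ≤ ∑< N f
term≤∑< {m = zero}  (suc N) 0≤f m<N       = p≤p+q (∑<-nonNeg N (0≤f ∘ suc))
term≤∑< {m = suc m} (suc N) 0≤f (s≤s m<N) = ℚₚ.≤-trans (term≤∑< N (0≤f ∘ suc) m<N) (q≤p+q (0≤f 0))

count≤∑< : ∀ {f} D N → D ℕ.≤ N → (∀ d → 0ℚ ≤ f d) → (∀ d → d ℕ.< D → f d ≡ 1ℚ) → ℕ→ℚ D ≤ ∑< N f
count≤∑< zero    N       _         0≤f _    = ∑<-nonNeg N 0≤f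
count≤∑< {f} (suc D) (suc N) (s≤s D≤N) 0≤f f≡1 = begin
  ℕ→ℚ (suc D)              ≡⟨ ℕ→ℚ-+ 1 D ⟩
  1ℚ + ℕ→ℚ D               ≤⟨ ℚₚ.+-mono-≤ (ℚₚ.≤-reflexive (sym (f≡1 0 (s≤s z≤n))))
                                          (count≤∑< D N D≤N (0≤f ∘ suc) (λ d d<D → f≡1 (suc d) (s≤s d<D))) ⟩
  f 0 + ∑< N (f ∘ suc)     ∎
  where open ℚₚ.≤-Reasoning

∑<-geometric : ∀ r T → 0ℚ ≤ r → 0ℚ ≤ T → r * T + 1ℚ ≤ T → ∀ N → ∑[ d < N ] (r ^ℚ d) ≤ T
∑<-geometric r T 0≤r 0≤T rT+1≤T zero    = 0≤T
∑<-geometric r T 0≤r 0≤T rT+1≤T (suc N) = begin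
  1ℚ + ∑[ d < N ] (r * r ^ℚ d)
    ≡⟨ cong (_+_ 1ℚ) (∑<-*-distribˡ r N) ⟩
  1ℚ + r * ∑[ d < N ] (r ^ℚ d)
    ≤⟨ ℚₚ.+-monoʳ-≤ 1ℚ (*-monoˡ-≤-nonNeg′ 0≤r (∑<-geometric r T 0≤r 0≤T rT+1≤T N)) ⟩
  1ℚ + r * T
    ≡⟨ ℚₚ.+-comm 1ℚ (r * T) ⟩
  r * T + 1ℚ
    ≤⟨ rT+1≤T ⟩
  T ∎
  where open ℚₚ.≤-Reasoning

∑<-geometric-½^ : ∀ m N → ∑[ d < N ] ((1ℚ - ½^ m) ^ℚ d) ≤ ℕ→ℚ (2 ^ m)
∑<-geometric-½^ m =
  ∑<-geometric (1ℚ - ½^ m) (ℕ→ℚ (2 ^ m)) (p≤q⇒0≤q-p (½^≤1 m)) (0≤ℕ→ℚ (2 ^ m)) (ℚₚ.≤-reflexive fixed)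
  where
  fixed : (1ℚ - ½^ m) * ℕ→ℚ (2 ^ m) + 1ℚ ≡ ℕ→ℚ (2 ^ m)
  fixed = begin
    (1ℚ - ½^ m) * ℕ→ℚ (2 ^ m) + 1ℚ
      ≡⟨ solve 2 (λ h t → (con 1ℚ :- h) :* t :+ con 1ℚ := t :+ (con 1ℚ :- h :* t)) refl (½^ m) (ℕ→ℚ (2 ^ m)) ⟩
    ℕ→ℚ (2 ^ m) + (1ℚ - ½^ m * ℕ→ℚ (2 ^ m))
      ≡⟨ cong (λ e → ℕ→ℚ (2 ^ m) + (1ℚ - e)) (½^*2^≡1 m) ⟩
    ℕ→ℚ (2 ^ m) + (1ℚ - 1ℚ)
      ≡⟨ ℚₚ.+-identityʳ _ ⟩
    ℕ→ℚ (2 ^ m) ∎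
    where open ≡-Reasoning

∏< : ℕ → (ℕ → ℚ) → ℚ
∏< zero    f = 1ℚ
∏< (suc N) f = f 0 * ∏< N (f ∘ suc)

syntax ∏< N (λ d → e) = ∏[ d < N ] e

∏<-nonNeg : ∀ {f} N → (∀ d → 0ℚ ≤ f d) → 0ℚ ≤ ∏< N f
∏<-nonNeg zero    0≤f = ℚₚ.≤ᵇ⇒≤ tt
∏<-nonNeg (suc N) 0≤f = *-nonNeg (0≤f 0) (∏<-nonNeg N (0≤f ∘ suc))

∏<-const : ∀ c N → ∏[ d < N ] c ≡ c ^ℚ N
∏<-const c zero    = refl
∏<-const c (suc N) = cong (c *_) (∏<-const c N)

∏<-<ᵇ-split : ∀ p q d → ∏[ i < suc d ] (if i <ᵇ d then p else q) ≡ p ^ℚ d * q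
∏<-<ᵇ-split p q zero    = trans (ℚₚ.*-identityʳ q) (sym (ℚₚ.*-identityˡ q))
∏<-<ᵇ-split p q (suc d) = trans (cong (p *_) (∏<-<ᵇ-split p q d)) (sym (ℚₚ.*-assoc p (p ^ℚ d) q))

-- Expectations over truncated geometric ranks

𝟙 : Bool → ℚ
𝟙 true  = 1ℚ
𝟙 false = 0ℚ

0≤𝟙 : ∀ b → 0ℚ ≤ 𝟙 b
0≤𝟙 true  = ℚₚ.≤ᵇ⇒≤ tt
0≤𝟙 false = ℚₚ.≤-refl

𝟙[≡_] 𝟙[<_] 𝟙[≥_] : ℕ → ℕ → ℚ
𝟙[≡ k ] j = 𝟙 (j ≡ᵇ k)
𝟙[< k ] j = 𝟙 (j <ᵇ k)
𝟙[≥ k ] j = 𝟙 (not (j <ᵇ k))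

𝟙-T : ∀ {b} → Data.Bool.T b → 𝟙 b ≡ 1ℚ
𝟙-T {true} _ = refl

𝟙[≡]≡1 : ∀ {j k} → j ≡ k → 𝟙[≡ k ] j ≡ 1ℚ
𝟙[≡]≡1 {j} {k} j≡k = 𝟙-T (ℕₚ.≡⇒≡ᵇ j k j≡k)

𝟙[<]≡1 : ∀ {j k} → j ℕ.< k → 𝟙[< k ] j ≡ 1ℚ
𝟙[<]≡1 j<k = 𝟙-T (ℕₚ.<⇒<ᵇ j<k)

E₁ : ℕ → (ℕ → ℚ) → ℚ
E₁ M g = ∑[ j < M ] (½^ (suc j) * g j)

E₁-suc : ∀ M g → E₁ (suc M) g ≡ ½ * g 0 + ½ * E₁ M (g ∘ suc)
E₁-suc M g = cong₂ _+_ (cong (_* g 0) (ℚₚ.*-identityʳ ½))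
  (trans (∑<-cong M (λ j → ℚₚ.*-assoc ½ (½^ (suc j)) (g (suc j)))) (∑<-*-distribˡ ½ M))

E₁-nonNeg : ∀ M {g} → (∀ j → 0ℚ ≤ g j) → 0ℚ ≤ E₁ M g
E₁-nonNeg M 0≤g = ∑<-nonNeg M (λ j → *-nonNeg (0≤½^ (suc j)) (0≤g j))

E₁-*ʳ : ∀ M g c → E₁ M (λ j → g j * c) ≡ E₁ M g * c
E₁-*ʳ M g c = begin
  ∑[ j < M ] (½^ (suc j) * (g j * c))
    ≡⟨ ∑<-cong M (λ j → solve 3 (λ h x c → h :* (x :* c) := c :* (h :* x)) refl (½^ (suc j)) (g j) c) ⟩
  ∑[ j < M ] (c * (½^ (suc j) * g j))
    ≡⟨ ∑<-*-distribˡ c M ⟩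
  c * E₁ M g
    ≡⟨ ℚₚ.*-comm c (E₁ M g) ⟩
  E₁ M g * c ∎
  where open ≡-Reasoning

E₁-0 : ∀ M → E₁ M (λ _ → 0ℚ) ≡ 0ℚ
E₁-0 zero    = refl
E₁-0 (suc M) = trans (E₁-suc M (λ _ → 0ℚ)) (cong (λ e → ½ * 0ℚ + ½ * e) (E₁-0 M))

E₁-1≤1 : ∀ M → E₁ M (λ _ → 1ℚ) ≤ 1ℚ
E₁-1≤1 zero    = ℚₚ.≤ᵇ⇒≤ tt
E₁-1≤1 (suc M) = begin
  E₁ (suc M) (λ _ → 1ℚ)                ≡⟨ E₁-suc M (λ _ → 1ℚ) ⟩
  ½ * 1ℚ + ½ * E₁ M (λ _ → 1ℚ)         ≤⟨ ℚₚ.+-monoʳ-≤ (½ * 1ℚ) (*-monoˡ-≤-nonNeg′ 0≤½ (E₁-1≤1 M)) ⟩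
  ½ * 1ℚ + ½ * 1ℚ                      ≡⟨⟩
  1ℚ                                   ∎
  where open ℚₚ.≤-Reasoning

E₁-𝟙[≡] : ∀ M k → E₁ M 𝟙[≡ k ] ≤ ½^ (suc k)
E₁-𝟙[≡] zero    k       = 0≤½^ (suc k)
E₁-𝟙[≡] (suc M) zero    =
  ℚₚ.≤-reflexive (trans (E₁-suc M 𝟙[≡ 0 ]) (cong (λ e → ½ * 1ℚ + ½ * e) (E₁-0 M)))
E₁-𝟙[≡] (suc M) (suc k) = begin
  E₁ (suc M) 𝟙[≡ suc k ]               ≡⟨ E₁-suc M 𝟙[≡ suc k ] ⟩
  ½ * 0ℚ + ½ * E₁ M 𝟙[≡ k ]            ≤⟨ ℚₚ.+-monoʳ-≤ (½ * 0ℚ) (*-monoˡ-≤-nonNeg′ 0≤½ (E₁-𝟙[≡] M k)) ⟩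
  ½ * 0ℚ + ½ * ½^ (suc k)              ≡⟨ ℚₚ.+-identityˡ _ ⟩
  ½^ (suc (suc k))                     ∎
  where open ℚₚ.≤-Reasoning

E₁-𝟙[<] : ∀ M k → E₁ M 𝟙[< k ] ≤ 1ℚ - ½^ k
E₁-𝟙[<] zero    k       = p≤q⇒0≤q-p (½^≤1 k)
E₁-𝟙[<] (suc M) zero    =
  ℚₚ.≤-reflexive (trans (E₁-suc M 𝟙[< 0 ]) (cong (λ e → ½ * 0ℚ + ½ * e) (E₁-0 M)))
E₁-𝟙[<] (suc M) (suc k) = begin
  E₁ (suc M) 𝟙[< suc k ]
    ≡⟨ E₁-suc M 𝟙[< suc k ] ⟩
  ½ * 1ℚ + ½ * E₁ M 𝟙[< k ]
    ≤⟨ ℚₚ.+-monoʳ-≤ (½ * 1ℚ) (*-monoˡ-≤-nonNeg′ 0≤½ (E₁-𝟙[<] M k)) ⟩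
  ½ * 1ℚ + ½ * (1ℚ - ½^ k)
    ≡⟨ solve 1 (λ h → con ½ :* con 1ℚ :+ con ½ :* (con 1ℚ :- h) := con 1ℚ :- con ½ :* h) refl (½^ k) ⟩
  1ℚ - ½^ (suc k) ∎
  where open ℚₚ.≤-Reasoning

E₁-𝟙[≥] : ∀ M k → E₁ M 𝟙[≥ k ] ≤ ½^ k
E₁-𝟙[≥] zero    k       = 0≤½^ k
E₁-𝟙[≥] (suc M) zero    = E₁-1≤1 (suc M)
E₁-𝟙[≥] (suc M) (suc k) = begin
  E₁ (suc M) 𝟙[≥ suc k ]               ≡⟨ E₁-suc M 𝟙[≥ suc k ] ⟩
  ½ * 0ℚ + ½ * E₁ M 𝟙[≥ k ]            ≤⟨ ℚₚ.+-monoʳ-≤ (½ * 0ℚ) (*-monoˡ-≤-nonNeg′ 0≤½ (E₁-𝟙[≥] M k)) ⟩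
  ½ * 0ℚ + ½ * ½^ k                    ≡⟨ ℚₚ.+-identityˡ _ ⟩
  ½^ (suc k)                           ∎
  where open ℚₚ.≤-Reasoning

sumℚ-++ : (xs ys : List ℚ) → sumℚ (xs ++ ys) ≡ sumℚ xs + sumℚ ys
sumℚ-++ []       ys = sym (ℚₚ.+-identityˡ _)
sumℚ-++ (x ∷ xs) ys = trans (cong (_+_ x) (sumℚ-++ xs ys)) (sym (ℚₚ.+-assoc x _ _))

module _ {A : Set} where

  sumℚ-map-concatMap : ∀ {B : Set} (φ : B → ℚ) (f : A → List B) xs →
                       sumℚ (map φ (concatMap f xs)) ≡ sumℚ (map (λ a → sumℚ (map φ (f a))) xs)
  sumℚ-map-concatMap φ f []       = refl
  sumℚ-map-concatMap φ f (x ∷ xs) = begin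
    sumℚ (map φ (f x ++ concatMap f xs))
      ≡⟨ cong sumℚ (Listₚ.map-++ φ (f x) (concatMap f xs)) ⟩
    sumℚ (map φ (f x) ++ map φ (concatMap f xs))
      ≡⟨ sumℚ-++ (map φ (f x)) _ ⟩
    sumℚ (map φ (f x)) + sumℚ (map φ (concatMap f xs))
      ≡⟨ cong (_+_ (sumℚ (map φ (f x)))) (sumℚ-map-concatMap φ f xs) ⟩
    sumℚ (map φ (f x)) + sumℚ (map (λ a → sumℚ (map φ (f a))) xs) ∎
    where open ≡-Reasoning

  sumℚ-map-mono : ∀ {f g : A → ℚ} xs → (∀ a → f a ≤ g a) → sumℚ (map f xs) ≤ sumℚ (map g xs)
  sumℚ-map-mono []       f≤g = ℚₚ.≤-refl
  sumℚ-map-mono (x ∷ xs) f≤g = ℚₚ.+-mono-≤ (f≤g x) (sumℚ-map-mono xs f≤g)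

  sumℚ-map-*ˡ : ∀ {f : A → ℚ} c xs → sumℚ (map (λ a → c * f a) xs) ≡ c * sumℚ (map f xs)
  sumℚ-map-*ˡ c []       = sym (ℚₚ.*-zeroʳ c)
  sumℚ-map-*ˡ {f} c (x ∷ xs) =
    trans (cong (_+_ (c * f x)) (sumℚ-map-*ˡ c xs)) (sym (ℚₚ.*-distribˡ-+ c (f x) _))

  sumℚ-map-+ : ∀ {f g : A → ℚ} xs → sumℚ (map (λ a → f a + g a) xs) ≡ sumℚ (map f xs) + sumℚ (map g xs)
  sumℚ-map-+ []       = refl
  sumℚ-map-+ {f} {g} (x ∷ xs) = trans (cong (_+_ (f x + g x)) (sumℚ-map-+ xs))
    (solve 4 (λ a b c d → (a :+ b) :+ (c :+ d) := (a :+ c) :+ (b :+ d)) refl (f x) (g x) _ _)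

sumℚ-map-applyUpTo : ∀ (φ : ℕ → ℚ) f N → sumℚ (map φ (applyUpTo f N)) ≡ ∑[ j < N ] φ (f j)
sumℚ-map-applyUpTo φ f zero    = refl
sumℚ-map-applyUpTo φ f (suc N) = cong (_+_ (φ (f 0))) (sumℚ-map-applyUpTo φ (f ∘ suc) N)

E : (n M : ℕ) → (Vector ℕ n → ℚ) → ℚ
E n M F = sumℚ (map (λ v → weight n v * F v) (rankVecs n M))

0≤weight : ∀ n v → 0ℚ ≤ weight n v
0≤weight zero    v = ℚₚ.≤ᵇ⇒≤ tt
0≤weight (suc n) v = *-nonNeg (0≤½^ (suc (v Fin.zero))) (0≤weight n (Vector.tail v))

E-suc : ∀ n M F → E (suc n) M F ≡ E₁ M (λ j → E n M (λ v → F (j Vector.∷ v)))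
E-suc n M F = begin
  E (suc n) M F
    ≡⟨ sumℚ-map-concatMap φ (λ j → map (j Vector.∷_) (rankVecs n M)) (upTo M) ⟩
  sumℚ (map (λ j → sumℚ (map φ (map (j Vector.∷_) (rankVecs n M)))) (upTo M))
    ≡⟨ cong sumℚ (Listₚ.map-cong (λ j → trans (cong sumℚ (sym (Listₚ.map-∘ (rankVecs n M))))
                                             (factor j)) (upTo M)) ⟩
  sumℚ (map (λ j → ½^ (suc j) * E n M (λ v → F (j Vector.∷ v))) (upTo M))
    ≡⟨ sumℚ-map-applyUpTo _ (λ j → j) M ⟩
  E₁ M (λ j → E n M (λ v → F (j Vector.∷ v)))  ∎
  where
  open ≡-Reasoning
  φ : Vector ℕ (suc n) → ℚ
  φ v = weight (suc n) v * F v
  factor : ∀ j → sumℚ (map (λ v → φ (j Vector.∷ v)) (rankVecs n M)) ≡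
                 ½^ (suc j) * E n M (λ v → F (j Vector.∷ v))
  factor j = trans
    (cong sumℚ (Listₚ.map-cong (λ v → ℚₚ.*-assoc (½^ (suc j)) (weight n v) (F (j Vector.∷ v))) (rankVecs n M)))
    (sumℚ-map-*ˡ (½^ (suc j)) (rankVecs n M))

E-mono : ∀ n M {F G} → (∀ v → F v ≤ G v) → E n M F ≤ E n M G
E-mono n M F≤G = sumℚ-map-mono (rankVecs n M) (λ v → *-monoˡ-≤-nonNeg′ (0≤weight n v) (F≤G v))

E-*ˡ : ∀ n M {F} c → E n M (λ v → c * F v) ≡ c * E n M F
E-*ˡ n M {F} c = trans
  (cong sumℚ (Listₚ.map-cong (λ v → swap (weight n v) c (F v)) (rankVecs n M)))
  (sumℚ-map-*ˡ c (rankVecs n M))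
  where
  swap : ∀ w c f → w * (c * f) ≡ c * (w * f)
  swap = solve 3 (λ w c f → w :* (c :* f) := c :* (w :* f)) refl

E-+ : ∀ n M {F G} → E n M (λ v → F v + G v) ≡ E n M F + E n M G
E-+ n M {F} {G} = trans
  (cong sumℚ (Listₚ.map-cong (λ v → ℚₚ.*-distribˡ-+ (weight n v) (F v) (G v)) (rankVecs n M)))
  (sumℚ-map-+ (rankVecs n M))

E-∑< : ∀ n M (F : ℕ → Vector ℕ n → ℚ) N → E n M (λ v → ∑[ d < N ] F d v) ≡ ∑[ d < N ] E n M (F d)
E-∑< n M F zero    = trans (E-*ˡ n M {λ _ → 0ℚ} 0ℚ) (ℚₚ.*-zeroˡ (E n M (λ _ → 0ℚ)))
E-∑< n M F (suc N) = trans (E-+ n M) (cong (_+_ (E n M (F 0))) (E-∑< n M (F ∘ suc) N))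

-- Independence of the ranks

∏ᵥ : (n : ℕ) → (ℕ → ℕ → ℚ) → Vector ℕ n → ℚ
∏ᵥ zero    h v = 1ℚ
∏ᵥ (suc n) h v = h 0 (v Fin.zero) * ∏ᵥ n (h ∘ suc) (Vector.tail v)

0≤∏ᵥ : ∀ n {h} v → (∀ p j → 0ℚ ≤ h p j) → 0ℚ ≤ ∏ᵥ n h v
0≤∏ᵥ zero    v 0≤h = ℚₚ.≤ᵇ⇒≤ tt
0≤∏ᵥ (suc n) v 0≤h = *-nonNeg (0≤h 0 _) (0≤∏ᵥ n (Vector.tail v) (0≤h ∘ suc))

E-∏ᵥ : ∀ n M h → E n M (∏ᵥ n h) ≡ ∏[ p < n ] E₁ M (h p)
E-∏ᵥ zero    M h = trans (ℚₚ.+-identityʳ _) (ℚₚ.*-identityˡ _)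
E-∏ᵥ (suc n) M h = begin
  E (suc n) M (∏ᵥ (suc n) h)
    ≡⟨ E-suc n M (∏ᵥ (suc n) h) ⟩
  E₁ M (λ j → E n M (λ v → h 0 j * ∏ᵥ n (h ∘ suc) v))
    ≡⟨ ∑<-cong M (λ j → cong (½^ (suc j) *_)
                              (trans (E-*ˡ n M (h 0 j)) (cong (h 0 j *_) (E-∏ᵥ n M (h ∘ suc))))) ⟩
  E₁ M (λ j → h 0 j * ∏[ p < n ] E₁ M (h (suc p)))
    ≡⟨ E₁-*ʳ M (h 0) _ ⟩
  E₁ M (h 0) * ∏[ p < n ] E₁ M (h (suc p))  ∎
  where open ≡-Reasoning

-- window a w f p is f (p ∸ a) for a ≤ p < a + w and the constant 1 at every other position p.
window : ℕ → ℕ → (ℕ → ℕ → ℚ) → ℕ → ℕ → ℚ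
window (suc a) w       f zero    = λ _ → 1ℚ
window (suc a) w       f (suc p) = window a w f p
window zero    zero    f p       = λ _ → 1ℚ
window zero    (suc w) f zero    = f 0
window zero    (suc w) f (suc p) = window zero w (f ∘ suc) p

0≤window : ∀ a w {f} p j → (∀ i j → 0ℚ ≤ f i j) → 0ℚ ≤ window a w f p j
0≤window (suc a) w       zero    j 0≤f = ℚₚ.≤ᵇ⇒≤ tt
0≤window (suc a) w       (suc p) j 0≤f = 0≤window a w p j 0≤f
0≤window zero    zero    p       j 0≤f = ℚₚ.≤ᵇ⇒≤ tt
0≤window zero    (suc w) zero    j 0≤f = 0≤f 0 j
0≤window zero    (suc w) (suc p) j 0≤f = 0≤window zero w p j (0≤f ∘ suc)

∏ᵥ-window≡1 : ∀ n a w {f} (v : Vector ℕ n) →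
              (∀ i j → j ℕ.< w → a ℕ.+ j ≡ toℕ i → f j (v i) ≡ 1ℚ) → ∏ᵥ n (window a w f) v ≡ 1ℚ
∏ᵥ-window≡1 zero    a       w           v f≡1 = refl
∏ᵥ-window≡1 (suc n) (suc a) w           v f≡1 =
  cong (1ℚ *_) (∏ᵥ-window≡1 n a w (Vector.tail v) (λ i j j<w eq → f≡1 (Fin.suc i) j j<w (cong suc eq)))
∏ᵥ-window≡1 (suc n) zero    zero    {f} v f≡1 =
  cong (1ℚ *_) (∏ᵥ-window≡1 n zero zero {f} (Vector.tail v) (λ _ _ ()))
∏ᵥ-window≡1 (suc n) zero    (suc w) {f} v f≡1 = cong₂ _*_ (f≡1 Fin.zero 0 (s≤s z≤n) refl)
  (∏ᵥ-window≡1 n zero w {f ∘ suc} (Vector.tail v)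
    (λ i j j<w eq → f≡1 (Fin.suc i) (suc j) (s≤s j<w) (cong suc eq)))

E₁-1*-≤ : ∀ M {P Q} → 0ℚ ≤ P → P ≤ Q → E₁ M (λ _ → 1ℚ) * P ≤ Q
E₁-1*-≤ M {P} 0≤P P≤Q =
  ℚₚ.≤-trans (*-monoʳ-≤-nonNeg′ 0≤P (E₁-1≤1 M)) (ℚₚ.≤-trans (ℚₚ.≤-reflexive (ℚₚ.*-identityˡ P)) P≤Q)

∏<-E₁-window≤ : ∀ M n a w {f : ℕ → ℕ → ℚ} {c : ℕ → ℚ} →
                a ℕ.+ w ℕ.≤ n → (∀ i j → 0ℚ ≤ f i j) → (∀ i → E₁ M (f i) ≤ c i) →
                ∏[ p < n ] E₁ M (window a w f p) ≤ ∏[ i < w ] c i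
∏<-E₁-window≤ M zero    zero    zero    _           _   _     = ℚₚ.≤-refl
∏<-E₁-window≤ M (suc n) (suc a) w {f} (s≤s a+w≤n) 0≤f E₁f≤c =
  E₁-1*-≤ M (∏<-nonNeg n (λ p → E₁-nonNeg M (λ j → 0≤window a w {f} p j 0≤f)))
            (∏<-E₁-window≤ M n a w a+w≤n 0≤f E₁f≤c)
∏<-E₁-window≤ M (suc n) zero    zero {f} _           0≤f E₁f≤c =
  E₁-1*-≤ M (∏<-nonNeg n (λ p → E₁-nonNeg M (λ j → 0≤window 0 0 {f} p j 0≤f)))
            (∏<-E₁-window≤ M n zero zero z≤n 0≤f E₁f≤c)
∏<-E₁-window≤ M (suc n) zero    (suc w) {f} {c} (s≤s w≤n)   0≤f E₁f≤c =
  *-mono-≤-nonNeg (E₁-nonNeg M (0≤f 0)) (∏<-nonNeg w (λ i → 0≤c (suc i))) (E₁f≤c 0)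
                  (∏<-E₁-window≤ M n zero w w≤n (0≤f ∘ suc) (E₁f≤c ∘ suc))
  where
  0≤c : ∀ i → 0ℚ ≤ c i
  0≤c i = ℚₚ.≤-trans (E₁-nonNeg M (0≤f i)) (E₁f≤c i)

E-window≤ : ∀ n M a w {f : ℕ → ℕ → ℚ} {c : ℕ → ℚ} →
            a ℕ.+ w ℕ.≤ n → (∀ i j → 0ℚ ≤ f i j) → (∀ i → E₁ M (f i) ≤ c i) →
            E n M (∏ᵥ n (window a w f)) ≤ ∏[ i < w ] c i
E-window≤ n M a w {f} a+w≤n 0≤f E₁f≤c =
  ℚₚ.≤-trans (ℚₚ.≤-reflexive (E-∏ᵥ n M (window a w f))) (∏<-E₁-window≤ M n a w a+w≤n 0≤f E₁f≤c)

-- Zip trees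

module _ {n : ℕ} where

  AllT-∈ : ∀ {P : Fin n → Set} {t x} → AllT P t → x ∈T t → P x
  AllT-∈ (_  , Px , _ ) here      = Px
  AllT-∈ (Pl , _  , _ ) (left m)  = AllT-∈ Pl m
  AllT-∈ (_  , _  , Pr) (right m) = AllT-∈ Pr m

  AllT-map : ∀ {P Q : Fin n → Set} {t} → (∀ {y} → P y → Q y) → AllT P t → AllT Q t
  AllT-map {t = leaf}       f _              = tt
  AllT-map {t = node l k r} f (Pl , Pk , Pr) = AllT-map f Pl , f Pk , AllT-map f Pr

  AllT-× : ∀ {P Q : Fin n → Set} {t} → AllT P t → AllT Q t → AllT (λ y → P y × Q y) t
  AllT-× {t = leaf}       _              _              = tt
  AllT-× {t = node l k r} (Pl , Pk , Pr) (Ql , Qk , Qr) = AllT-× Pl Ql , (Pk , Qk) , AllT-× Pr Qr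

  infix 4 _⊑_

  data _⊑_ : Tree n → Tree n → Set where
    ⊑-refl : ∀ {t} → t ⊑ t
    ⊑-left  : ∀ {s l k r} → s ⊑ l → s ⊑ node l k r
    ⊑-right : ∀ {s l k r} → s ⊑ r → s ⊑ node l k r

  ⊑-AllT : ∀ {P : Fin n → Set} {s t} → s ⊑ t → AllT P t → AllT P s
  ⊑-AllT ⊑-refl       Pt           = Pt
  ⊑-AllT (⊑-left  s⊑) (Pl , _ , _) = ⊑-AllT s⊑ Pl
  ⊑-AllT (⊑-right s⊑) (_ , _ , Pr) = ⊑-AllT s⊑ Pr

  ⊑-IsZip : ∀ {ρ : Fin n → ℕ} {s t} → s ⊑ t → IsZip ρ t → IsZip ρ s
  ⊑-IsZip ⊑-refl       Z                     = Z
  ⊑-IsZip (⊑-left  s⊑) (_ , _ , _ , _ , Zl , _) = ⊑-IsZip s⊑ Zl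
  ⊑-IsZip (⊑-right s⊑) (_ , _ , _ , _ , _ , Zr) = ⊑-IsZip s⊑ Zr

  ⊑-separates : ∀ {ρ : Fin n → ℕ} {s t z} → s ⊑ t → IsZip ρ t → z ∈T t →
                z ∈T s ⊎ AllT (z Fin.<_) s ⊎ AllT (Fin._< z) s
  ⊑-separates ⊑-refl       _                       z∈t       = inj₁ z∈t
  ⊑-separates (⊑-left  s⊑) (l<k , _ , _)           here      = inj₂ (inj₂ (⊑-AllT s⊑ l<k))
  ⊑-separates (⊑-left  s⊑) (_ , _ , _ , _ , Zl , _) (left m)  = ⊑-separates s⊑ Zl m
  ⊑-separates (⊑-left  s⊑) (l<k , k<r , _)         (right m) =
    inj₂ (inj₂ (AllT-map (λ y<k → ℕₚ.<-trans y<k (AllT-∈ k<r m)) (⊑-AllT s⊑ l<k)))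
  ⊑-separates (⊑-right s⊑) (_ , k<r , _)           here      = inj₂ (inj₁ (⊑-AllT s⊑ k<r))
  ⊑-separates (⊑-right s⊑) (l<k , k<r , _)         (left m)  =
    inj₂ (inj₁ (AllT-map (λ k<y → ℕₚ.<-trans (AllT-∈ l<k m) k<y) (⊑-AllT s⊑ k<r)))
  ⊑-separates (⊑-right s⊑) (_ , _ , _ , _ , _ , Zr) (right m) = ⊑-separates s⊑ Zr m

  desc-∉ : ∀ {x : Fin n} t → ¬ x ∈T t → desc x t ≡ 0
  desc-∉ leaf _ = refl
  desc-∉ {x} (node l k r) x∉t with x Finₚ.≟ k
  ... | yes refl = ⊥-elim (x∉t here)
  ... | no _     = cong₂ ℕ._+_ (desc-∉ l (x∉t ∘ left)) (desc-∉ r (x∉t ∘ right))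

  desc-∈ : ∀ {ρ : Fin n → ℕ} t {x} → IsZip ρ t → x ∈T t →
           Σ[ l ∈ Tree n ] Σ[ r ∈ Tree n ] node l x r ⊑ t × desc x t ≡ suc (size l ℕ.+ size r)
  desc-∈ (node l k r) {x} _ _ with x Finₚ.≟ k
  desc-∈ (node l k r) {x} _ _          | yes refl = l , r , ⊑-refl , refl
  desc-∈ (node l k r) {x} _ here       | no x≢k   = ⊥-elim (x≢k refl)
  desc-∈ (node l k r) {x} (l<k , k<r , _ , _ , Zl , _) (left m)  | no _ with desc-∈ l Zl m
  ... | l′ , r′ , ⊑l , eq = l′ , r′ , ⊑-left ⊑l ,
        trans (cong₂ ℕ._+_ eq (desc-∉ r (λ m′ → ℕₚ.<-asym (AllT-∈ l<k m) (AllT-∈ k<r m′))))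
              (ℕₚ.+-identityʳ _)
  desc-∈ (node l k r) {x} (l<k , k<r , _ , _ , _ , Zr) (right m) | no _ with desc-∈ r Zr m
  ... | l′ , r′ , ⊑r , eq = l′ , r′ , ⊑-right ⊑r ,
        trans (cong (ℕ._+ desc x r) (desc-∉ l (λ m′ → ℕₚ.<-asym (AllT-∈ l<k m′) (AllT-∈ k<r m)))) eq

  rank≤root : ∀ {ρ : Fin n → ℕ} {l k r z} → IsZip ρ (node l k r) → z ∈T node l k r → ρ z ℕ.≤ ρ k
  rank≤root _ here = ℕₚ.≤-refl
  rank≤root {l = node _ _ _} (_ , _ , ρl<ρk , _ , Zl , _) (left m)  = ℕₚ.≤-trans (rank≤root Zl m) (ℕₚ.<⇒≤ ρl<ρk)
  rank≤root {r = node _ _ _} (_ , _ , _ , ρr≤ρk , _ , Zr) (right m) = ℕₚ.≤-trans (rank≤root Zr m) ρr≤ρk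

  rank<root-left : ∀ {ρ : Fin n → ℕ} {l k r z} → IsZip ρ (node l k r) → z ∈T l → ρ z ℕ.< ρ k
  rank<root-left {l = node _ _ _} (_ , _ , ρl<ρk , _ , Zl , _) m = ℕₚ.≤-<-trans (rank≤root Zl m) ρl<ρk

  rank≤root-right : ∀ {ρ : Fin n → ℕ} {l k r z} → IsZip ρ (node l k r) → z ∈T r → ρ z ℕ.≤ ρ k
  rank≤root-right {r = node _ _ _} (_ , _ , _ , ρr≤ρk , _ , Zr) m = ℕₚ.≤-trans (rank≤root Zr m) ρr≤ρk

  size+lo≤hi : ∀ {ρ : Fin n → ℕ} u {lo hi} → IsZip ρ u → AllT (λ y → lo ℕ.≤ toℕ y × toℕ y ℕ.< hi) u →
               lo ℕ.≤ hi → size u ℕ.+ lo ℕ.≤ hi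
  size+lo≤hi leaf _ _ lo≤hi = lo≤hi
  size+lo≤hi (node l k r) {lo} {hi} (l<k , k<r , _ , _ , Zl , Zr) (inl , (lo≤k , k<hi) , inr) _ = begin
    suc (size l ℕ.+ size r) ℕ.+ lo    ≡⟨ cong suc (trans (cong (ℕ._+ lo) (ℕₚ.+-comm (size l) (size r)))
                                                        (ℕₚ.+-assoc (size r) (size l) lo)) ⟩
    suc (size r ℕ.+ (size l ℕ.+ lo))  ≡⟨ ℕₚ.+-suc (size r) (size l ℕ.+ lo) ⟨
    size r ℕ.+ suc (size l ℕ.+ lo)    ≤⟨ ℕₚ.+-monoʳ-≤ (size r) (s≤s size-l) ⟩
    size r ℕ.+ suc (toℕ k)            ≤⟨ size-r ⟩
    hi                                ∎
    where
    open ℕₚ.≤-Reasoning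
    size-l : size l ℕ.+ lo ℕ.≤ toℕ k
    size-l = size+lo≤hi l Zl (AllT-× (AllT-map proj₁ inl) l<k) lo≤k
    size-r : size r ℕ.+ suc (toℕ k) ℕ.≤ hi
    size-r = size+lo≤hi r Zr (AllT-× k<r (AllT-map proj₂ inr)) k<hi

  record Span (ρ : Fin n → ℕ) (t : Tree n) (x : Fin n) : Set where
    field
      below above   : ℕ
      desc≡         : desc x t ≡ suc (below ℕ.+ above)
      below≤x       : below ℕ.≤ toℕ x
      above≤        : above ℕ.≤ n ∸ suc (toℕ x)
      ranks-below   : ∀ z → toℕ x ∸ below ℕ.≤ toℕ z → toℕ z ℕ.< toℕ x → ρ z ℕ.< ρ x
      ranks-above   : ∀ z → toℕ x ℕ.< toℕ z → toℕ z ℕ.≤ toℕ x ℕ.+ above → ρ z ℕ.≤ ρ x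

  span : ∀ {ρ : Fin n → ℕ} {t} → IsZipTreeOn ρ t → ∀ x → Span ρ t x
  span {ρ} {t} (Z , cover) x with desc-∈ t Z (cover x)
  ... | l , r , node⊑t , desc≡ with ⊑-IsZip node⊑t Z
  ... | Zs@(l<x , x<r , _ , _ , Zl , Zr) = record
    { below       = size l
    ; above       = size r
    ; desc≡       = desc≡
    ; below≤x     = subst (ℕ._≤ toℕ x) (ℕₚ.+-identityʳ (size l))
                      (size+lo≤hi l Zl (AllT-map (λ y<x → z≤n , y<x) l<x) z≤n)
    ; above≤      = ℕₚ.m+n≤o⇒m≤o∸n (size r)
                      (size+lo≤hi r Zr (AllT-map (λ x<y → x<y , Finₚ.toℕ<n _) x<r) (Finₚ.toℕ<n x))
    ; ranks-below = ranks-below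
    ; ranks-above = ranks-above
    }
    where
    ranks-below : ∀ z → toℕ x ∸ size l ℕ.≤ toℕ z → toℕ z ℕ.< toℕ x → ρ z ℕ.< ρ x
    ranks-below z lo≤z z<x with ⊑-separates node⊑t Z (cover z)
    ... | inj₁ here      = ⊥-elim (ℕₚ.<-irrefl refl z<x)
    ... | inj₁ (left m)  = rank<root-left Zs m
    ... | inj₁ (right m) = ⊥-elim (ℕₚ.<-asym z<x (AllT-∈ x<r m))
    ... | inj₂ (inj₂ (_ , x<z , _)) = ⊥-elim (ℕₚ.<-asym z<x x<z)
    -- Otherwise l would lie strictly between z and x, too narrow a range for its size.
    ... | inj₂ (inj₁ (z<l , _ , _)) = ⊥-elim (ℕₚ.n≮n _ (begin-strict
      suc (size l ℕ.+ toℕ z) ≡⟨ sym (ℕₚ.+-suc (size l) (toℕ z)) ⟩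
      size l ℕ.+ suc (toℕ z) ≤⟨ size+lo≤hi l Zl (AllT-× z<l l<x) z<x ⟩
      toℕ x                  ≤⟨ ℕₚ.m≤n+m∸n (toℕ x) (size l) ⟩
      size l ℕ.+ (toℕ x ∸ size l) ≤⟨ ℕₚ.+-monoʳ-≤ (size l) lo≤z ⟩
      size l ℕ.+ toℕ z       <⟨ ℕₚ.n<1+n _ ⟩
      suc (size l ℕ.+ toℕ z) ∎))
      where open ℕₚ.≤-Reasoning

    ranks-above : ∀ z → toℕ x ℕ.< toℕ z → toℕ z ℕ.≤ toℕ x ℕ.+ size r → ρ z ℕ.≤ ρ x
    ranks-above z x<z z≤hi with ⊑-separates node⊑t Z (cover z)
    ... | inj₁ here      = ⊥-elim (ℕₚ.<-irrefl refl x<z)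
    ... | inj₁ (left m)  = ⊥-elim (ℕₚ.<-asym x<z (AllT-∈ l<x m))
    ... | inj₁ (right m) = rank≤root-right Zs m
    ... | inj₂ (inj₁ (_ , z<x , _)) = ⊥-elim (ℕₚ.<-asym z<x x<z)
    ... | inj₂ (inj₂ (_ , _ , r<z)) = ⊥-elim (ℕₚ.n≮n _ (begin-strict
      size r ℕ.+ toℕ x       <⟨ ℕₚ.n<1+n _ ⟩
      suc (size r ℕ.+ toℕ x) ≡⟨ sym (ℕₚ.+-suc (size r) (toℕ x)) ⟩
      size r ℕ.+ suc (toℕ x) ≤⟨ size+lo≤hi r Zr (AllT-× x<r r<z) x<z ⟩
      toℕ z                  ≤⟨ z≤hi ⟩
      toℕ x ℕ.+ size r       ≡⟨ ℕₚ.+-comm (toℕ x) (size r) ⟩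
      size r ℕ.+ toℕ x       ∎))
      where open ℕₚ.≤-Reasoning

-- Rank events around a node

leftPattern : ℕ → ℕ → ℕ → ℕ → ℚ
leftPattern k d i = if i <ᵇ d then 𝟙[< k ] else 𝟙[≡ k ]

leftPattern-below : ∀ {k d i} → i ℕ.< d → leftPattern k d i ≡ 𝟙[< k ]
leftPattern-below {k} {d} {i} i<d with i <ᵇ d | ℕₚ.<⇒<ᵇ i<d
... | true | _ = refl

leftPattern-at : ∀ k d → leftPattern k d d ≡ 𝟙[≡ k ]
leftPattern-at k d with d <ᵇ d | ℕₚ.<ᵇ⇒< d d
... | true  | d<d = ⊥-elim (ℕₚ.n≮n d (d<d tt))
... | false | _   = refl

0≤leftPattern : ∀ k d i j → 0ℚ ≤ leftPattern k d i j
0≤leftPattern k d i j with i <ᵇ d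
... | true  = 0≤𝟙 (j <ᵇ k)
... | false = 0≤𝟙 (j ≡ᵇ k)

rightPattern : ℕ → ℕ → ℕ → ℚ
rightPattern k zero    = 𝟙[≡ k ]
rightPattern k (suc _) = 𝟙[< suc k ]

0≤rightPattern : ∀ k i j → 0ℚ ≤ rightPattern k i j
0≤rightPattern k zero    j = 0≤𝟙 (j ≡ᵇ k)
0≤rightPattern k (suc i) j = 0≤𝟙 (j <ᵇ suc k)

module _ {n : ℕ} (x : Fin n) where

  -- leftEvent k d: x has rank k and the d keys just below x have rank < k.
  -- rightEvent k d: x has rank k and the d + 1 keys just above x have rank ≤ k.
  leftEvent rightEvent : ℕ → ℕ → Vector ℕ n → ℚ
  leftEvent  k d = ∏ᵥ n (window (toℕ x ∸ d) (suc d) (leftPattern k d))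
  rightEvent k d = ∏ᵥ n (window (toℕ x) (suc (suc d)) (rightPattern k))

  rankAtLeast : ℕ → Vector ℕ n → ℚ
  rankAtLeast K = ∏ᵥ n (window (toℕ x) 1 (λ _ → 𝟙[≥ K ]))

  0≤leftEvent : ∀ k d ρ → 0ℚ ≤ leftEvent k d ρ
  0≤leftEvent k d ρ = 0≤∏ᵥ n ρ (λ p j → 0≤window (toℕ x ∸ d) (suc d) p j (0≤leftPattern k d))

  0≤rightEvent : ∀ k d ρ → 0ℚ ≤ rightEvent k d ρ
  0≤rightEvent k d ρ = 0≤∏ᵥ n ρ (λ p j → 0≤window (toℕ x) (suc (suc d)) p j (0≤rightPattern k))

  0≤rankAtLeast : ∀ K ρ → 0ℚ ≤ rankAtLeast K ρ
  0≤rankAtLeast K ρ = 0≤∏ᵥ n ρ (λ p j → 0≤window (toℕ x) 1 p j (λ _ j → 0≤𝟙 (not (j <ᵇ K))))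

  E-leftEvent≤ : ∀ M k d → d ℕ.≤ toℕ x → E n M (leftEvent k d) ≤ (1ℚ - ½^ k) ^ℚ d * ½^ (suc k)
  E-leftEvent≤ M k d d≤x = ℚₚ.≤-trans
    (E-window≤ n M (toℕ x ∸ d) (suc d) fits (0≤leftPattern k d) E₁-pattern≤)
    (ℚₚ.≤-reflexive (∏<-<ᵇ-split (1ℚ - ½^ k) (½^ (suc k)) d))
    where
    fits : toℕ x ∸ d ℕ.+ suc d ℕ.≤ n
    fits = subst (ℕ._≤ n) (trans (cong suc (sym (ℕₚ.m∸n+n≡m d≤x))) (sym (ℕₚ.+-suc (toℕ x ∸ d) d)))
                 (Finₚ.toℕ<n x)
    E₁-pattern≤ : ∀ i → E₁ M (leftPattern k d i) ≤ (if i <ᵇ d then 1ℚ - ½^ k else ½^ (suc k))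
    E₁-pattern≤ i with i <ᵇ d
    ... | true  = E₁-𝟙[<] M k
    ... | false = E₁-𝟙[≡] M k

  E-rightEvent≤ : ∀ M k d → d ℕ.< n ∸ suc (toℕ x) →
                  E n M (rightEvent k d) ≤ ½^ (suc k) * ((1ℚ - ½^ (suc k)) * (1ℚ - ½^ (suc k)) ^ℚ d)
  E-rightEvent≤ M k d d<n-x = ℚₚ.≤-trans
    (E-window≤ n M (toℕ x) (suc (suc d)) fits (0≤rightPattern k) E₁-pattern≤)
    (ℚₚ.≤-reflexive (cong (λ P → ½^ (suc k) * ((1ℚ - ½^ (suc k)) * P)) (∏<-const (1ℚ - ½^ (suc k)) d)))
    where
    fits : toℕ x ℕ.+ suc (suc d) ℕ.≤ n
    fits = subst (ℕ._≤ n) (trans (ℕₚ.+-comm (suc d) (suc (toℕ x))) (sym (ℕₚ.+-suc (toℕ x) (suc d))))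
                 (ℕₚ.m≤o∸n⇒m+n≤o (suc d) (Finₚ.toℕ<n x) d<n-x)
    rightBound : ℕ → ℚ
    rightBound zero    = ½^ (suc k)
    rightBound (suc _) = 1ℚ - ½^ (suc k)
    E₁-pattern≤ : ∀ i → E₁ M (rightPattern k i) ≤ rightBound i
    E₁-pattern≤ zero    = E₁-𝟙[≡] M k
    E₁-pattern≤ (suc i) = E₁-𝟙[<] M (suc k)

  E-rankAtLeast≤ : ∀ M K → E n M (rankAtLeast K) ≤ ½^ K
  E-rankAtLeast≤ M K = ℚₚ.≤-trans
    (E-window≤ n M (toℕ x) 1 fits (λ _ j → 0≤𝟙 (not (j <ᵇ K))) (λ _ → E₁-𝟙[≥] M K))
    (ℚₚ.≤-reflexive (ℚₚ.*-identityʳ (½^ K)))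
    where
    fits : toℕ x ℕ.+ 1 ℕ.≤ n
    fits = subst (ℕ._≤ n) (ℕₚ.+-comm 1 (toℕ x)) (Finₚ.toℕ<n x)

  module _ {ρ : Fin n → ℕ} {t : Tree n} (S : Span ρ t x) where
    open Span S

    leftEvent≡1 : ∀ {k d} → ρ x ≡ k → d ℕ.≤ below → leftEvent k d ρ ≡ 1ℚ
    leftEvent≡1 {k} {d} ρx≡k d≤below = ∏ᵥ-window≡1 n (toℕ x ∸ d) (suc d) ρ factor≡1
      where
      d≤x : d ℕ.≤ toℕ x
      d≤x = ℕₚ.≤-trans d≤below below≤x
      factor≡1 : ∀ i j → j ℕ.< suc d → toℕ x ∸ d ℕ.+ j ≡ toℕ i → leftPattern k d j (ρ i) ≡ 1ℚ
      factor≡1 i j (s≤s j≤d) x-d+j≡i with ℕₚ.m≤n⇒m<n∨m≡n j≤d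
      ... | inj₁ j<d rewrite leftPattern-below {k} j<d =
        𝟙[<]≡1 (subst (ρ i ℕ.<_) ρx≡k (ranks-below i lo≤i i<x))
        where
        lo≤i : toℕ x ∸ below ℕ.≤ toℕ i
        lo≤i = ℕₚ.≤-trans (ℕₚ.∸-monoʳ-≤ (toℕ x) d≤below) (subst (toℕ x ∸ d ℕ.≤_) x-d+j≡i (ℕₚ.m≤m+n _ j))
        i<x : toℕ i ℕ.< toℕ x
        i<x = subst₂ ℕ._<_ x-d+j≡i (ℕₚ.m∸n+n≡m d≤x) (ℕₚ.+-monoʳ-< (toℕ x ∸ d) j<d)
      ... | inj₂ refl rewrite leftPattern-at k j =
        𝟙[≡]≡1 (trans (cong ρ (sym x≡i)) ρx≡k)
        where
        x≡i : x ≡ i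
        x≡i = Finₚ.toℕ-injective (trans (sym (ℕₚ.m∸n+n≡m d≤x)) x-d+j≡i)

    rightEvent≡1 : ∀ {k d} → ρ x ≡ k → d ℕ.< above → rightEvent k d ρ ≡ 1ℚ
    rightEvent≡1 {k} {d} ρx≡k d<above = ∏ᵥ-window≡1 n (toℕ x) (suc (suc d)) ρ factor≡1
      where
      factor≡1 : ∀ i j → j ℕ.< suc (suc d) → toℕ x ℕ.+ j ≡ toℕ i → rightPattern k j (ρ i) ≡ 1ℚ
      factor≡1 i zero    _ x+0≡i = 𝟙[≡]≡1 (trans (cong ρ (sym x≡i)) ρx≡k)
        where
        x≡i : x ≡ i
        x≡i = Finₚ.toℕ-injective (trans (sym (ℕₚ.+-identityʳ (toℕ x))) x+0≡i)
      factor≡1 i (suc j) (s≤s (s≤s j≤d)) x+j≡i =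
        𝟙[<]≡1 (s≤s (subst (ρ i ℕ.≤_) ρx≡k (ranks-above i x<i i≤hi)))
        where
        x<i : toℕ x ℕ.< toℕ i
        x<i = subst (toℕ x ℕ.<_) x+j≡i (ℕₚ.m<m+n (toℕ x) (s≤s z≤n))
        i≤hi : toℕ i ℕ.≤ toℕ x ℕ.+ above
        i≤hi = subst (ℕ._≤ toℕ x ℕ.+ above) x+j≡i (ℕₚ.+-monoʳ-≤ (toℕ x) (ℕₚ.≤-trans (s≤s j≤d) d<above))

    desc≤n : desc x t ℕ.≤ n
    desc≤n = begin
      desc x t                          ≡⟨ desc≡ ⟩
      suc below ℕ.+ above               ≤⟨ ℕₚ.+-mono-≤ (s≤s below≤x) above≤ ⟩
      suc (toℕ x) ℕ.+ (n ∸ suc (toℕ x)) ≡⟨ ℕₚ.m+[n∸m]≡n (Finₚ.toℕ<n x) ⟩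
      n                                 ∎
      where open ℕₚ.≤-Reasoning

  rankAtLeast≡1 : ∀ {K} (ρ : Vector ℕ n) → ¬ ρ x ℕ.< K → rankAtLeast K ρ ≡ 1ℚ
  rankAtLeast≡1 {K} ρ ρx≮K = ∏ᵥ-window≡1 n (toℕ x) 1 ρ factor≡1
    where
    factor≡1 : ∀ i j → j ℕ.< 1 → toℕ x ℕ.+ j ≡ toℕ i → 𝟙[≥ K ] (ρ i) ≡ 1ℚ
    factor≡1 i (suc _) (s≤s ()) _
    factor≡1 i zero _ x+0≡i rewrite sym (Finₚ.toℕ-injective (trans (sym (ℕₚ.+-identityʳ (toℕ x))) x+0≡i))
      with ρ x <ᵇ K | ℕₚ.<ᵇ⇒< (ρ x) K
    ... | true  | ρx<K = ⊥-elim (ρx≮K (ρx<K tt))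
    ... | false | _    = refl

module _ {n : ℕ} (zt : (Fin n → ℕ) → Tree n) (zip : ∀ ρ → IsZipTreeOn ρ (zt ρ)) (x : Fin n) where

  descₓ : Vector ℕ n → ℚ
  descₓ ρ = ℕ→ℚ (desc x (zt ρ))

  descAtRank : ℕ → Vector ℕ n → ℚ
  descAtRank k ρ = if ⌊ ρ x ℕ.≟ k ⌋ then descₓ ρ else 0ℚ

  partialECond≡E : ∀ M k → partialECond n M zt x k ≡ E n M (descAtRank k)
  partialECond≡E M k = cong sumℚ (Listₚ.map-cong weight-inside (rankVecs n M))
    where
    weight-inside : ∀ ρ → (if ⌊ ρ x ℕ.≟ k ⌋ then weight n ρ * descₓ ρ else 0ℚ) ≡ weight n ρ * descAtRank k ρ
    weight-inside ρ with ⌊ ρ x ℕ.≟ k ⌋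
    ... | true  = refl
    ... | false = sym (ℚₚ.*-zeroʳ (weight n ρ))

  0≤descAtRank : ∀ k ρ → 0ℚ ≤ descAtRank k ρ
  0≤descAtRank k ρ with ⌊ ρ x ℕ.≟ k ⌋
  ... | true  = 0≤ℕ→ℚ (desc x (zt ρ))
  ... | false = ℚₚ.≤-refl

  descAtRank≤events : ∀ k ρ →
    descAtRank k ρ ≤ ∑[ d < suc (toℕ x) ] leftEvent x k d ρ + ∑[ d < n ∸ suc (toℕ x) ] rightEvent x k d ρ
  descAtRank≤events k ρ with ρ x ℕ.≟ k
  ... | no _     = +-nonNeg (∑<-nonNeg (suc (toℕ x)) (λ d → 0≤leftEvent x k d ρ))
                            (∑<-nonNeg (n ∸ suc (toℕ x)) (λ d → 0≤rightEvent x k d ρ))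
  ... | yes ρx≡k = begin
    ℕ→ℚ (desc x (zt ρ))              ≡⟨ trans (cong ℕ→ℚ desc≡) (ℕ→ℚ-+ (suc below) above) ⟩
    ℕ→ℚ (suc below) + ℕ→ℚ above      ≤⟨ ℚₚ.+-mono-≤
      (count≤∑< (suc below) (suc (toℕ x)) (s≤s below≤x) (λ d → 0≤leftEvent x k d ρ)
                (λ { d (s≤s d≤below) → leftEvent≡1 x S ρx≡k d≤below }))
      (count≤∑< above (n ∸ suc (toℕ x)) above≤ (λ d → 0≤rightEvent x k d ρ)
                (λ d d<above → rightEvent≡1 x S ρx≡k d<above)) ⟩
    ∑[ d < suc (toℕ x) ] leftEvent x k d ρ + ∑[ d < n ∸ suc (toℕ x) ] rightEvent x k d ρ ∎
    where
    open ℚₚ.≤-Reasoning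
    S = span (zip ρ) x
    open Span S

  E-descAtRank≤ : ∀ M k → E n M (descAtRank k) ≤ (+ 3) / 2 - ½^ (suc k)
  E-descAtRank≤ M k = begin
    E n M (descAtRank k)
      ≤⟨ E-mono n M (descAtRank≤events k) ⟩
    E n M (λ ρ → ∑[ d < suc X ] leftEvent x k d ρ + ∑[ d < N ] rightEvent x k d ρ)
      ≡⟨ trans (E-+ n M) (cong₂ _+_ (E-∑< n M (leftEvent x k) (suc X)) (E-∑< n M (rightEvent x k) N)) ⟩
    ∑[ d < suc X ] E n M (leftEvent x k d) + ∑[ d < N ] E n M (rightEvent x k d)
      ≤⟨ ℚₚ.+-mono-≤ (∑<-mono (suc X) (λ { d (s≤s d≤X) → E-leftEvent≤ x M k d d≤X }))
                     (∑<-mono N (λ d d<N → E-rightEvent≤ x M k d d<N)) ⟩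
    ∑[ d < suc X ] (r ^ℚ d * A) + ∑[ d < N ] (A * (r′ * r′ ^ℚ d))
      ≡⟨ cong₂ _+_ (∑<-*-distribʳ {r ^ℚ_} A (suc X))
                   (trans (∑<-*-distribˡ {λ d → r′ * r′ ^ℚ d} A N) (cong (A *_) (∑<-*-distribˡ {r′ ^ℚ_} r′ N))) ⟩
    ∑[ d < suc X ] (r ^ℚ d) * A + A * (r′ * ∑[ d < N ] (r′ ^ℚ d))
      ≤⟨ ℚₚ.+-mono-≤ (*-monoʳ-≤-nonNeg′ (0≤½^ (suc k)) (∑<-geometric-½^ k (suc X)))
                     (*-monoˡ-≤-nonNeg′ (0≤½^ (suc k)) (*-monoˡ-≤-nonNeg′ 0≤r′ (∑<-geometric-½^ (suc k) N))) ⟩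
    ℕ→ℚ (2 ^ k) * A + A * (r′ * ℕ→ℚ (2 ^ suc k))
      ≡⟨ cong₂ _+_ (solve 2 (λ t h → t :* (con ½ :* h) := con ½ :* (h :* t)) refl (ℕ→ℚ (2 ^ k)) (½^ k))
                   (solve 3 (λ a r T → a :* (r :* T) := r :* (a :* T)) refl A r′ (ℕ→ℚ (2 ^ suc k))) ⟩
    ½ * (½^ k * ℕ→ℚ (2 ^ k)) + r′ * (A * ℕ→ℚ (2 ^ suc k))
      ≡⟨ cong₂ (λ a b → ½ * a + r′ * b) (½^*2^≡1 k) (½^*2^≡1 (suc k)) ⟩
    ½ * 1ℚ + (1ℚ - A) * 1ℚ
      ≡⟨ solve 1 (λ a → con ½ :* con 1ℚ :+ (con 1ℚ :- a) :* con 1ℚ := con ((+ 3) / 2) :- a) refl A ⟩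
    (+ 3) / 2 - A ∎
    where
    open ℚₚ.≤-Reasoning
    X = toℕ x
    N = n ∸ suc X
    A = ½^ (suc k)
    r = 1ℚ - ½^ k
    r′ = 1ℚ - ½^ (suc k)
    0≤r′ : 0ℚ ≤ r′
    0≤r′ = p≤q⇒0≤q-p (½^≤1 (suc k))

  descAtRank-own : ∀ ρ → descAtRank (ρ x) ρ ≡ descₓ ρ
  descAtRank-own ρ with ρ x ℕ.≟ ρ x
  ... | yes _      = refl
  ... | no ρx≢ρx   = ⊥-elim (ρx≢ρx refl)

  desc≤byRank : ∀ K ρ → descₓ ρ ≤ ∑[ k < K ] descAtRank k ρ + ℕ→ℚ n * rankAtLeast x K ρ
  desc≤byRank K ρ with ρ x ℕ.<? K
  ... | yes ρx<K = begin
    descₓ ρ                                    ≡⟨ descAtRank-own ρ ⟨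
    descAtRank (ρ x) ρ                         ≤⟨ term≤∑< K (λ k → 0≤descAtRank k ρ) ρx<K ⟩
    ∑[ k < K ] descAtRank k ρ                  ≤⟨ p≤p+q (*-nonNeg (0≤ℕ→ℚ n) (0≤rankAtLeast x K ρ)) ⟩
    ∑[ k < K ] descAtRank k ρ + ℕ→ℚ n * rankAtLeast x K ρ ∎
    where open ℚₚ.≤-Reasoning
  ... | no ρx≮K = begin
    descₓ ρ                                    ≤⟨ ℕ→ℚ-mono-≤ (desc≤n x (span (zip ρ) x)) ⟩
    ℕ→ℚ n                                      ≡⟨ ℚₚ.*-identityʳ (ℕ→ℚ n) ⟨
    ℕ→ℚ n * 1ℚ                                 ≡⟨ cong (ℕ→ℚ n *_) (rankAtLeast≡1 x ρ ρx≮K) ⟨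
    ℕ→ℚ n * rankAtLeast x K ρ                  ≤⟨ q≤p+q (∑<-nonNeg K (λ k → 0≤descAtRank k ρ)) ⟩
    ∑[ k < K ] descAtRank k ρ + ℕ→ℚ n * rankAtLeast x K ρ ∎
    where open ℚₚ.≤-Reasoning

  E-desc≤ : ∀ M K → E n M descₓ ≤ ℕ→ℚ K * ((+ 3) / 2) + ℕ→ℚ n * ½^ K
  E-desc≤ M K = begin
    E n M descₓ
      ≤⟨ E-mono n M (desc≤byRank K) ⟩
    E n M (λ ρ → ∑[ k < K ] descAtRank k ρ + ℕ→ℚ n * rankAtLeast x K ρ)
      ≡⟨ trans (E-+ n M) (cong₂ _+_ (E-∑< n M descAtRank K) (E-*ˡ n M (ℕ→ℚ n))) ⟩
    ∑[ k < K ] E n M (descAtRank k) + ℕ→ℚ n * E n M (rankAtLeast x K)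
      ≤⟨ ℚₚ.+-mono-≤ (∑<-mono K (λ k _ → ℚₚ.≤-trans (E-descAtRank≤ M k) (p-q≤p ((+ 3) / 2) (0≤½^ (suc k)))))
                     (*-monoˡ-≤-nonNeg′ (0≤ℕ→ℚ n) (E-rankAtLeast≤ x M K)) ⟩
    ∑[ k < K ] ((+ 3) / 2) + ℕ→ℚ n * ½^ K
      ≡⟨ cong (_+ ℕ→ℚ n * ½^ K) (∑<-const ((+ 3) / 2) K) ⟩
    ℕ→ℚ K * ((+ 3) / 2) + ℕ→ℚ n * ½^ K ∎
    where open ℚₚ.≤-Reasoning

2^[1+k]*[3/2-½^[1+k]] : ∀ k → ℕ→ℚ (2 ^ suc k) * ((+ 3) / 2 - ½^ (suc k)) ≡ ℕ→ℚ (3 ℕ.* 2 ^ k ∸ 1)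
2^[1+k]*[3/2-½^[1+k]] k = begin
  ℕ→ℚ (2 ^ suc k) * ((+ 3) / 2 - ½^ (suc k))
    ≡⟨ solve 2 (λ T h → T :* (con ((+ 3) / 2) :- h) := con ((+ 3) / 2) :* T :- h :* T) refl
               (ℕ→ℚ (2 ^ suc k)) (½^ (suc k)) ⟩
  (+ 3) / 2 * ℕ→ℚ (2 ℕ.* 2 ^ k) - ½^ (suc k) * ℕ→ℚ (2 ^ suc k)
    ≡⟨ cong₂ (λ a b → (+ 3) / 2 * a - b) (ℕ→ℚ-* 2 (2 ^ k)) (½^*2^≡1 (suc k)) ⟩
  (+ 3) / 2 * (ℕ→ℚ 2 * ℕ→ℚ (2 ^ k)) - 1ℚ
    ≡⟨ cong (_- 1ℚ) (solve 1 (λ t → con ((+ 3) / 2) :* (con (ℕ→ℚ 2) :* t) := con (ℕ→ℚ 3) :* t) refl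
                              (ℕ→ℚ (2 ^ k))) ⟩
  ℕ→ℚ 3 * ℕ→ℚ (2 ^ k) - 1ℚ
    ≡⟨ cong (_- 1ℚ) (ℕ→ℚ-* 3 (2 ^ k)) ⟨
  ℕ→ℚ (3 ℕ.* 2 ^ k) - ℕ→ℚ 1
    ≡⟨ ℕ→ℚ-∸ (ℕₚ.≤-trans (ℕₚ.m^n>0 2 k) (ℕₚ.m≤m+n (2 ^ k) _)) ⟨
  ℕ→ℚ (3 ℕ.* 2 ^ k ∸ 1) ∎
  where open ≡-Reasoning

n*½^m≤1 : ∀ {n m} → n ℕ.≤ 2 ^ m → ℕ→ℚ n * ½^ m ≤ 1ℚ
n*½^m≤1 {n} {m} n≤2^m = begin
  ℕ→ℚ n * ½^ m         ≤⟨ *-monoʳ-≤-nonNeg′ (0≤½^ m) (ℕ→ℚ-mono-≤ n≤2^m) ⟩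
  ℕ→ℚ (2 ^ m) * ½^ m   ≡⟨ ℚₚ.*-comm (ℕ→ℚ (2 ^ m)) (½^ m) ⟩
  ½^ m * ℕ→ℚ (2 ^ m)   ≡⟨ ½^*2^≡1 m ⟩
  1ℚ                   ∎
  where open ℚₚ.≤-Reasoning

2^m≤n<2^[1+m] : ∀ n → 1 ℕ.≤ n → Σ[ m ∈ ℕ ] 2 ^ m ℕ.≤ n × n ℕ.< 2 ^ suc m
2^m≤n<2^[1+m] (suc zero)       _ = 0 , s≤s z≤n , s≤s (s≤s z≤n)
2^m≤n<2^[1+m] (suc (suc n)) _ with 2^m≤n<2^[1+m] (suc n) (s≤s z≤n)
... | m , 2^m≤1+n , 1+n<2^[1+m] with suc (suc n) ℕ.<? 2 ^ suc m
...   | yes 2+n<2^[1+m] = m , ℕₚ.≤-trans 2^m≤1+n (ℕₚ.n≤1+n _) , 2+n<2^[1+m]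
...   | no  2+n≮2^[1+m] = suc m , ℕₚ.≮⇒≥ 2+n≮2^[1+m] ,
        ℕₚ.≤-<-trans 1+n<2^[1+m] (ℕₚ.m<m+n (2 ^ suc m) (ℕₚ.≤-trans (ℕₚ.m^n>0 2 (suc m)) (ℕₚ.m≤m+n _ 0)))

≤lg-intro : ∀ q m N → q ≤ ℕ→ℚ m → 2 ^ m ℕ.≤ N → q ≤lg N
≤lg-intro (mkℚ -[1+ a ] d _) m N _ _ = inj₁ ℤ.-≤+
≤lg-intro (mkℚ (+ a) d c) m N q≤m 2^m≤N with subst (mkℚ (+ a) d c ≤_) (ℕ→ℚ≡mkℚ m) q≤m
... | *≤* a*1≤m*[1+d] = inj₂ (begin
  2 ^ a                ≤⟨ ℕₚ.^-monoʳ-≤ 2 a≤m*[1+d] ⟩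
  2 ^ (m ℕ.* suc d)    ≡⟨ ℕₚ.^-*-assoc 2 m (suc d) ⟨
  (2 ^ m) ^ suc d      ≤⟨ ℕₚ.^-monoˡ-≤ (suc d) 2^m≤N ⟩
  N ^ suc d            ∎)
  where
  open ℕₚ.≤-Reasoning
  a≤m*[1+d] : a ℕ.≤ m ℕ.* suc d
  a≤m*[1+d] = subst (ℕ._≤ m ℕ.* suc d) (ℕₚ.*-identityʳ a)
    (ℤₚ.drop‿+≤+ (subst₂ ℤ._≤_ (sym (ℤₚ.pos-* a 1)) (sym (ℤₚ.pos-* m (suc d))) a*1≤m*[1+d]))

⅔[P-3]≤m : ∀ P m → P ≤ ℕ→ℚ (suc m) * ((+ 3) / 2) + 1ℚ → ((+ 2) / 3) * (P - ℕ→ℚ 3) ≤ ℕ→ℚ m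
⅔[P-3]≤m P m P≤ = begin
  ((+ 2) / 3) * (P - ℕ→ℚ 3)
    ≤⟨ *-monoˡ-≤-nonNeg′ {(+ 2) / 3} (ℚₚ.≤ᵇ⇒≤ tt) (ℚₚ.+-monoˡ-≤ (- ℕ→ℚ 3) P≤) ⟩
  ((+ 2) / 3) * (ℕ→ℚ (suc m) * ((+ 3) / 2) + 1ℚ - ℕ→ℚ 3)
    ≡⟨ cong (λ e → ((+ 2) / 3) * (e * ((+ 3) / 2) + 1ℚ - ℕ→ℚ 3)) (ℕ→ℚ-+ 1 m) ⟩
  ((+ 2) / 3) * ((1ℚ + ℕ→ℚ m) * ((+ 3) / 2) + 1ℚ - ℕ→ℚ 3)
    ≡⟨ solve 1 (λ x → con ((+ 2) / 3) :* ((con 1ℚ :+ x) :* con ((+ 3) / 2) :+ con 1ℚ :- con (ℕ→ℚ 3))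
        := x :- con ((+ 1) / 3)) refl (ℕ→ℚ m) ⟩
  ℕ→ℚ m - (+ 1) / 3
    ≤⟨ p-q≤p (ℕ→ℚ m) {(+ 1) / 3} (ℚₚ.≤ᵇ⇒≤ tt) ⟩
  ℕ→ℚ m ∎
  where open ℚₚ.≤-Reasoning

theorem6 : (n : ℕ) → 1 ℕ.< n →
    (zt : (Fin n → ℕ) → Tree n) →
    (∀ ρ → IsZipTreeOn ρ (zt ρ)) →
    ((x : Fin n) (k M : ℕ) →
        ℕ→ℚ (2 ^ suc k) * partialECond n M zt x k ≤ ℕ→ℚ (3 ℕ.* 2 ^ k ∸ 1))
    × ((x : Fin n) (M : ℕ) →
        (((+ 2) / 3) * (partialE n M zt x - ℕ→ℚ 3)) ≤lg n)
theorem6 n 1<n zt zip = conditional , unconditional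
  where
  open ℚₚ.≤-Reasoning

  conditional : ∀ x k M → ℕ→ℚ (2 ^ suc k) * partialECond n M zt x k ≤ ℕ→ℚ (3 ℕ.* 2 ^ k ∸ 1)
  conditional x k M = begin
    ℕ→ℚ (2 ^ suc k) * partialECond n M zt x k
      ≡⟨ cong (ℕ→ℚ (2 ^ suc k) *_) (partialECond≡E zt zip x M k) ⟩
    ℕ→ℚ (2 ^ suc k) * E n M (descAtRank zt zip x k)
      ≤⟨ *-monoˡ-≤-nonNeg′ (0≤ℕ→ℚ (2 ^ suc k)) (E-descAtRank≤ zt zip x M k) ⟩
    ℕ→ℚ (2 ^ suc k) * ((+ 3) / 2 - ½^ (suc k))
      ≡⟨ 2^[1+k]*[3/2-½^[1+k]] k ⟩
    ℕ→ℚ (3 ℕ.* 2 ^ k ∸ 1) ∎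

  unconditional : ∀ x M → (((+ 2) / 3) * (partialE n M zt x - ℕ→ℚ 3)) ≤lg n
  unconditional x M with 2^m≤n<2^[1+m] n (ℕₚ.<⇒≤ 1<n)
  ... | m , 2^m≤n , n<2^[1+m] = ≤lg-intro _ m n (⅔[P-3]≤m _ m partialE≤) 2^m≤n
    where
    partialE≤ : partialE n M zt x ≤ ℕ→ℚ (suc m) * ((+ 3) / 2) + 1ℚ
    partialE≤ = ℚₚ.≤-trans (E-desc≤ zt zip x M (suc m))
                           (ℚₚ.+-monoʳ-≤ (ℕ→ℚ (suc m) * ((+ 3) / 2)) (n*½^m≤1 {n} {suc m} (ℕₚ.<⇒≤ n<2^[1+m])))
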